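{- Let $\preceq$ be an ordering of $\mathbb{M}$, let $(\mathcal{N}=((V,E),\rho),\lambda)$ be a leaf-labeled network, let $\phi=\phi_{(\lambda,\preceq)}$ be the full labeling of $\mathcal{N}$ produced by Algorithm 1, let $(\mathcal{T}',\phi')=\mathfrak{U}(\mathcal{N},\phi)$, and let $\lambda':L(\mathcal{T}')\to\mathbb{N}^*$ be given by $\lambda'(v')=\phi'(v')$ for all leaves $v'$ of $\mathcal{T}'$. Then the full labeling $\phi_{(\lambda',\preceq)}$ of $\mathcal{T}'$ produced by Algorithm 1 coincides with $\phi'$.
   Context: All graphs are finite. A rooted network $\mathcal{N}=(G,\rho)$ is a directed acyclic graph $G=(V,E)$ with a unique vertex $\rho$ of in-degree $0$ (the root). A leaf is a vertex of out-degree $0$; $L(\mathcal{N})$ is the set of leaves; non-leaf vertices are interior vertices; $C_u=\{v:(u,v)\in E\}$ is the set of children of $u$. Let $\mathbb{N}^*=\{1,2,3,\dots\}$. A leaf labeling is any map $\lambda:L(\mathcal{N})\to\mathbb{N}^*$ (not necessarily injective); $(\mathcal{N},\lambda)$ is a leaf-labeled network. A full labeling is a map $\phi:V\to\mathbb{N}^*$, and $(\mathcal{N},\phi)$ is a fully labeled network (a fully labeled tree if all in-degrees are at most $1$). For an interior vertex $u$, $F_{(u,\phi)}$ is the multiset $\{\phi(v):v\in C_u\}$. $\mathbb{M}$ is the set of all finite non-empty multisets of elements of $\mathbb{N}^*$; an ordering $\preceq$ of $\mathbb{M}$ is a total order on $\mathbb{M}$. Algorithm 1 (input: $\preceq$ and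 $(\mathcal{N},\lambda)$): set $\phi(v)=\lambda(v)$ for every leaf $v$; set $\mathbb{L}=\lambda(L(\mathcal{N}))$ and $U$ = set of interior vertices. While $U\neq\emptyset$: let $W$ be the set of $u\in U$ all of whose children already have a label; let $W'$ be the set of $w\in W$ with $F_{(w,\phi)}$ equal to the $\preceq$-minimum of $\{F_{(w',\phi)}:w'\in W\}$; let $k=\min(\mathbb{N}^*\setminus\mathbb{L})$; set $\phi(w)=k$ for $w\in W'$; add $k$ to $\mathbb{L}$; remove $W'$ from $U$. The output is denoted $\phi_{(\lambda,\preceq)}$. Unfolding: for a fully labeled network $(\mathcal{N}=((V,E),\rho),\phi)$, $\mathfrak{U}(\mathcal{N},\phi)$ is the fully labeled tree $(((V',E'),\rho'),\phi')$ where $V'$ is the set of all directed paths in $\mathcal{N}$ starting at $\rho$ (ending at any vertex); $(\pi,\pi')\in E'$ iff $\pi'$ is obtained from $\pi$ by extending it along one arc of $E$; $\rho'$ is the path consisting of $\rho$ alone; and $\phi'(\pi)=\phi(u)$ where $u$ is the last vertex of $\pi$. -}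

module Defs where

open import Data.Nat using (ℕ; _≤_; _<_)
open import Data.Fin using (Fin)
open import Data.List using (List; []; _∷_; length; lookup; allFin; map)
open import Data.List.Relation.Unary.Unique.Propositional using (Unique)
open import Data.List.Relation.Unary.All using (All)
open import Data.List.Membership.Propositional using (_∈_; _∉_)
open import Data.List.Relation.Binary.Permutation.Propositional using (_↭_)
open import Data.Maybe using (Maybe; just; nothing)
open import Data.Product using (Σ; Σ-syntax; ∃; _×_; _,_)
open import Data.Sum using (_⊎_)
open import Data.Unit using (⊤; tt)
open import Data.Empty using (⊥)
open import Relation.Nullary using (¬_)
open import Relation.Binary.PropositionalEquality using (_≡_; _≢_)
open import Function.Bundles using (_⇔_)

isLeaf : ∀ {A : Set} → List A → Set
isLeaf []      = ⊤
isLeaf (_ ∷ _) = ⊥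

-- 𝕄 : finite non-empty multisets over ℕ* = {1,2,...}, represented by
-- lists of positive naturals, considered up to permutation (_↭_).

InM : List ℕ → Set
InM []       = ⊥
InM (x ∷ xs) = All (1 ≤_) (x ∷ xs)

record IsOrderingOfM (_⪯_ : List ℕ → List ℕ → Set) : Set where
  field
    reflexive : ∀ xs ys → InM xs → InM ys → xs ↭ ys → xs ⪯ ys
    trans     : ∀ xs ys zs → InM xs → InM ys → InM zs →
                xs ⪯ ys → ys ⪯ zs → xs ⪯ zs
    antisym   : ∀ xs ys → InM xs → InM ys → xs ⪯ ys → ys ⪯ xs → xs ↭ ys
    total     : ∀ xs ys → InM xs → InM ys → (xs ⪯ ys) ⊎ (ys ⪯ xs)

-- Rooted networks on the finite vertex set Fin n, given by the
-- children lists ch u (= C_u; the arc set is E = {(u,v) : v ∈ ch u}).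

data Reach⁺ {n : ℕ} (ch : Fin n → List (Fin n)) : Fin n → Fin n → Set where
  edge : ∀ {u v} → v ∈ ch u → Reach⁺ ch u v
  step : ∀ {u v w} → v ∈ ch u → Reach⁺ ch v w → Reach⁺ ch u w

record IsRootedNetwork (n : ℕ) (ch : Fin n → List (Fin n)) (ρ : Fin n) : Set where
  field
    -- C_u is a set (E is a set of arcs)
    children-unique : ∀ u → Unique (ch u)
    acyclic         : ∀ v → ¬ Reach⁺ ch v v
    root-indeg0     : ∀ u → ρ ∉ ch u
    others-have-parent : ∀ v → v ≢ ρ → Σ[ u ∈ Fin n ] v ∈ ch u

-- Algorithm 1, as a relation "a run of Algorithm 1 on (ch, λ) outputs φ",
-- for an arbitrary vertex type V with children lists ch.

module Algorithm1 (_⪯_ : List ℕ → List ℕ → Set) {V : Set} (ch : V → List V) where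

  Leaf : V → Set
  Leaf v = isLeaf (ch v)

  labels : (V → Maybe ℕ) → List V → Maybe (List ℕ)
  labels φ [] = just []
  labels φ (v ∷ vs) with φ v | labels φ vs
  ... | just x | just xs = just (x ∷ xs)
  ... | _      | _       = nothing

  initAux : (xs : List V) → (isLeaf xs → ℕ) → Maybe ℕ
  initAux []      f = just (f tt)
  initAux (_ ∷ _) f = nothing

  -- state: current partial labelling φ, set 𝕃 of used labels, set U
  record State : Set₁ where
    field
      lab  : V → Maybe ℕ
      used : ℕ → Set
      U    : V → Set
  open State public

  Init : (λ' : (v : V) → Leaf v → ℕ) → State
  Init λ' = record
    { lab  = λ v → initAux (ch v) (λ' v)
    ; used = λ j → Σ[ v ∈ V ] Σ[ p ∈ Leaf v ] λ' v p ≡ j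
    ; U    = λ v → ¬ Leaf v }

  IsMinFree : (ℕ → Set) → ℕ → Set
  IsMinFree 𝕃 k = 1 ≤ k × ¬ 𝕃 k × (∀ j → 1 ≤ j → j < k → 𝕃 j)

  FW : State → V → List ℕ → Set
  FW s u m = U s u × labels (lab s) (ch u) ≡ just m

  IsMinF : State → List ℕ → Set
  IsMinF s M = (Σ[ w ∈ V ] FW s w M) × (∀ w m → FW s w m → M ⪯ m)

  W' : State → List ℕ → V → Set
  W' s M w = Σ[ m ∈ List ℕ ] FW s w m × m ↭ M

  data Step (s s' : State) : Set where
    step : (M : List ℕ) (k : ℕ) →
           (Σ[ u ∈ V ] U s u) →
           IsMinF s M →
           IsMinFree (used s) k →
           (∀ v → W' s M v → lab s' v ≡ just k) →
           (∀ v → ¬ W' s M v → lab s' v ≡ lab s v) →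
           (∀ j → used s' j ⇔ (used s j ⊎ j ≡ k)) →
           (∀ v → U s' v ⇔ (U s v × ¬ W' s M v)) →
           Step s s'

  data Run : State → (V → ℕ) → Set₁ where
    done : ∀ {s out} → (∀ v → ¬ U s v) → (∀ v → lab s v ≡ just (out v)) → Run s out
    next : ∀ {s out} (s' : State) → Step s s' → Run s' out → Run s out

  Alg1 : ((v : V) → Leaf v → ℕ) → (V → ℕ) → Set₁
  Alg1 λ' φ = Run (Init λ') φ

module Unfolding {n : ℕ} (ch : Fin n → List (Fin n)) (ρ : Fin n) where

  -- directed paths from ρ, indexed by their last vertex; an extension
  -- step picks a child by its position in the list ch u
  data PathTo : Fin n → Set where
    start : PathTo ρ
    ext   : ∀ {u} → PathTo u → (i : Fin (length (ch u))) → PathTo (lookup (ch u) i)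

  V' : Set
  V' = Σ (Fin n) PathTo

  ch' : V' → List V'
  ch' (u , p) = map (λ i → lookup (ch u) i , ext p i) (allFin (length (ch u)))

  unfoldLab : (Fin n → ℕ) → V' → ℕ
  unfoldLab φ (u , p) = φ u

  unfoldLeafLab : (Fin n → ℕ) → (x : V') → isLeaf (ch' x) → ℕ
  unfoldLeafLab φ x _ = unfoldLab φ x

{-# OPTIONS --safe #-}
module Submission where

-- Algorithm 1 sees a vertex only through the multiset of labels of its
-- children. Sending a path of the unfolding to its last vertex is a
-- surjection (every vertex lies below the root, since the network is
-- acyclic with a unique source) which maps the children list of a path
-- onto the children list of its last vertex. Pulling a run on the network
-- back along such a map therefore gives, step by step, a run on the
-- unfolding with the same minimal multisets and the same fresh labels, and
-- its output is φ'. For a total order on 𝕄 each step of Algorithm 1 is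
-- determined (the minimal multiset up to permutation, the fresh label
-- exactly), so φ' is the only output.

open import Defs
open import Data.Nat using (ℕ; _≤_; _<_; zero; suc; _≤?_)
open import Data.Nat.Properties using (<-cmp; <-trans; n<1+n; m<n⇒m<1+n; m<1+n⇒m<n∨m≡n)
import Data.Nat as ℕ
open import Data.Fin using (Fin; toℕ; fromℕ<; _≟_)
open import Data.Fin.Properties using (any?; pigeonhole; toℕ<n; toℕ-fromℕ<)
open import Data.List using (List; []; _∷_; map; tabulate; lookup; length; allFin)
open import Data.List.Properties using (map-∘; map-tabulate; tabulate-lookup)
open import Data.List.Relation.Unary.All using (All; []; _∷_)
open import Data.List.Relation.Unary.Any using (index)
open import Data.List.Relation.Unary.Any.Properties using (lookup-index)
open import Data.List.Membership.Propositional using (_∈_)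
open import Data.List.Relation.Binary.Permutation.Propositional using (_↭_; ↭-trans; ↭-sym)
open import Data.Maybe using (Maybe; just; nothing)
open import Data.Maybe.Properties using (just-injective; ≡-dec)
open import Data.Product using (Σ; Σ-syntax; _×_; _,_; proj₁; proj₂; map₂)
open import Data.Product.Function.NonDependent.Propositional using (_×-⇔_)
open import Data.Sum using (inj₁; inj₂)
open import Data.Sum.Function.Propositional using (_⊎-⇔_)
open import Data.Unit using (tt)
open import Data.Empty using (⊥-elim)
open import Function using (_∘_; id)
open import Function.Bundles using (_⇔_; mk⇔; Equivalence)
open import Function.Properties.Equivalence using (⇔-isEquivalence)
open import Level using (0ℓ)
open import Function.Related.TypeIsomorphisms using (¬-cong-⇔)
open import Relation.Binary using (IsEquivalence; tri<; tri≈; tri>)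
open import Relation.Binary.PropositionalEquality using (_≡_; _≢_; refl; sym; trans; cong; subst; module ≡-Reasoning)
open import Relation.Nullary using (¬_; Dec)
open import Relation.Nullary.Decidable using (decidable-stable; yes; no)

open Equivalence using (to; from)
open IsEquivalence (⇔-isEquivalence {ℓ = 0ℓ}) using () renaming (refl to ⇔-refl; sym to ⇔-sym; trans to ⇔-trans)

decidable-by-cases : {P G : Set} → Dec G → (P → G) → (¬ P → G) → G
decidable-by-cases G? f g = decidable-stable G? (λ ¬G → ¬G (g (¬G ∘ f)))

isLeaf-map : {A B : Set} {f : A → B} (xs : List A) → isLeaf xs ⇔ isLeaf (map f xs)
isLeaf-map []      = ⇔-refl
isLeaf-map (_ ∷ _) = ⇔-refl

module RunProperties (_⪯_ : List ℕ → List ℕ → Set) {V : Set} (ch : V → List V) where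
  open Algorithm1 _⪯_ ch

  PositiveLabels : (V → Maybe ℕ) → Set
  PositiveLabels f = ∀ v a → f v ≡ just a → 1 ≤ a

  labels-cong : {f g : V → Maybe ℕ} → (∀ v → f v ≡ g v) → ∀ xs → labels f xs ≡ labels g xs
  labels-cong f≗g []       = refl
  labels-cong f≗g (x ∷ xs) rewrite f≗g x | labels-cong f≗g xs = refl

  labels-positive : {f : V → Maybe ℕ} → PositiveLabels f → ∀ xs {M} → labels f xs ≡ just M → All (1 ≤_) M
  labels-positive pos []       refl = []
  labels-positive {f} pos (x ∷ xs) eq with f x in fx | labels f xs in fxs
  labels-positive pos (x ∷ xs) refl | just a  | just as = pos x a fx ∷ labels-positive pos xs fxs
  labels-positive pos (x ∷ xs) ()   | just a  | nothing
  labels-positive pos (x ∷ xs) ()   | nothing | _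

  labels-InM : {f : V → Maybe ℕ} → PositiveLabels f → ∀ xs {M} → ¬ isLeaf xs → labels f xs ≡ just M → InM M
  labels-InM pos []       ¬leaf eq = ⊥-elim (¬leaf tt)
  labels-InM {f} pos (x ∷ xs) ¬leaf eq with f x in fx | labels f xs in fxs
  labels-InM pos (x ∷ xs) ¬leaf refl | just a  | just as = pos x a fx ∷ labels-positive pos xs fxs
  labels-InM pos (x ∷ xs) ¬leaf ()   | just a  | nothing
  labels-InM pos (x ∷ xs) ¬leaf ()   | nothing | _

  initAux-leaf : ∀ xs (leaf : isLeaf xs) (h : isLeaf xs → ℕ) → initAux xs h ≡ just (h leaf)
  initAux-leaf [] tt h = refl

  initAux-positive : ∀ xs (h : isLeaf xs → ℕ) → (∀ q → 1 ≤ h q) → PositiveLabels (λ _ → initAux xs h)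
  initAux-positive [] h pos _ _ refl = pos tt

  IsMinFree-unique : {A : ℕ → Set} {k k′ : ℕ} → IsMinFree A k → IsMinFree A k′ → k ≡ k′
  IsMinFree-unique {k = k} {k′} (1≤k , k∉ , below-k) (1≤k′ , k′∉ , below-k′) with <-cmp k k′
  ... | tri< k<k′ _ _ = ⊥-elim (k∉ (below-k′ k 1≤k k<k′))
  ... | tri≈ _ k≡k′ _ = k≡k′
  ... | tri> _ _ k′<k = ⊥-elim (k′∉ (below-k k′ 1≤k′ k′<k))

  IsMinFree-resp : {A B : ℕ → Set} {k : ℕ} → (∀ j → A j ⇔ B j) → IsMinFree A k → IsMinFree B k
  IsMinFree-resp A⇔B (1≤k , k∉ , below-k) =
    1≤k , k∉ ∘ from (A⇔B _) , λ j 1≤j j<k → to (A⇔B j) (below-k j 1≤j j<k)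

  -- Positivity and interiority make every multiset Algorithm 1 compares a
  -- member of 𝕄, the only place where ⪯ is antisymmetric.
  record WellFormed (s : State) : Set where
    field
      U-interior   : ∀ v → U s v → ¬ Leaf v
      lab-positive : PositiveLabels (lab s)

  WellFormed-Init : {λ₀ : (v : V) → Leaf v → ℕ} → (∀ v q → 1 ≤ λ₀ v q) → WellFormed (Init λ₀)
  WellFormed-Init {λ₀} pos = record
    { U-interior   = λ v ¬leaf → ¬leaf
    ; lab-positive = λ v → initAux-positive (ch v) (λ₀ v) (pos v) v }

  FW-InM : ∀ {s w M} → WellFormed s → FW s w M → InM M
  FW-InM {w = w} wf (Uw , eq) = labels-InM lab-positive (ch w) (U-interior w Uw) eq
    where open WellFormed wf

  WellFormed-step : ∀ {s s′} → WellFormed s → Step s s′ → WellFormed s′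
  WellFormed-step {s′ = s′} wf (step _ _ _ _ (1≤k , _) lab-W' lab-¬W' _ U′⇔) = record
    { U-interior   = λ v U′v → U-interior v (proj₁ (to (U′⇔ v) U′v))
    ; lab-positive = positive }
    where
    open WellFormed wf
    positive : PositiveLabels (lab s′)
    positive v a eq = decidable-by-cases (1 ≤? a)
      (λ inW' → subst (1 ≤_) (just-injective (trans (sym (lab-W' v inW')) eq)) 1≤k)
      (λ ∉W' → lab-positive v a (trans (sym (lab-¬W' v ∉W')) eq))

  record _≋_ (s t : State) : Set where
    field
      lab-≡  : ∀ v → lab s v ≡ lab t v
      used-⇔ : ∀ j → used s j ⇔ used t j
      U-⇔    : ∀ v → U s v ⇔ U t v

  ≋-sym : ∀ {s t} → s ≋ t → t ≋ s
  ≋-sym e = record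
    { lab-≡  = λ v → sym (lab-≡ v)
    ; used-⇔ = λ j → ⇔-sym (used-⇔ j)
    ; U-⇔    = λ v → ⇔-sym (U-⇔ v) }
    where open _≋_ e

  FW-resp : ∀ {s t w m} → s ≋ t → FW s w m → FW t w m
  FW-resp {w = w} e (Uw , eq) = to (U-⇔ w) Uw , trans (sym (labels-cong lab-≡ (ch w))) eq
    where open _≋_ e

  W'-⇔ : ∀ {s t M v} → s ≋ t → W' s M v ⇔ W' t M v
  W'-⇔ e = mk⇔ (λ (m , fw , m↭M) → m , FW-resp e fw , m↭M)
               (λ (m , fw , m↭M) → m , FW-resp (≋-sym e) fw , m↭M)

  Step-resp-≋ : ∀ {s t s′} → s ≋ t → Step s s′ → Step t s′
  Step-resp-≋ e (step M k (u , Uu) ((w , fw) , M-min) k-free lab-W' lab-¬W' used′⇔ U′⇔) =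
    step M k (u , to (U-⇔ u) Uu)
      ((w , FW-resp e fw) , λ w′ m fw′ → M-min w′ m (FW-resp (≋-sym e) fw′))
      (IsMinFree-resp used-⇔ k-free)
      (λ v inW' → lab-W' v (from (W'-⇔ e) inW'))
      (λ v ∉W' → trans (lab-¬W' v (∉W' ∘ to (W'-⇔ e))) (lab-≡ v))
      (λ j → ⇔-trans (used′⇔ j) (used-⇔ j ⊎-⇔ ⇔-refl))
      (λ v → ⇔-trans (U′⇔ v) (U-⇔ v ×-⇔ ¬-cong-⇔ (W'-⇔ e)))
    where open _≋_ e

  Run-resp-≋ : ∀ {s t out} → s ≋ t → Run s out → Run t out
  Run-resp-≋ e (done ¬U labs) = done (λ v → ¬U v ∘ from (U-⇔ v)) (λ v → trans (sym (lab-≡ v)) (labs v))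
    where open _≋_ e
  Run-resp-≋ e (next s′ st r) = next s′ (Step-resp-≋ e st) r

  W'⇒U : ∀ {s M v} → W' s M v → U s v
  W'⇒U (_ , (Uv , _) , _) = Uv

  Run-final-label : ∀ {s out v a} → Run s out → ¬ U s v → lab s v ≡ just a → out v ≡ a
  Run-final-label {v = v} (done _ labs) _ eq = just-injective (trans (sym (labs v)) eq)
  Run-final-label {s} {v = v} (next s′ (step M _ _ _ _ _ lab-¬W' _ U′⇔) r) ¬Uv eq =
    Run-final-label r (¬Uv ∘ proj₁ ∘ to (U′⇔ v)) (trans (lab-¬W' v (¬Uv ∘ W'⇒U {s} {M})) eq)

  Alg1-leaf : ∀ {λ₀ : (v : V) → Leaf v → ℕ} {out : V → ℕ} →
              Alg1 λ₀ out → ∀ v (q : Leaf v) → out v ≡ λ₀ v q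
  Alg1-leaf {λ₀} run v q = Run-final-label run (λ ¬leaf → ¬leaf q) (initAux-leaf (ch v) q (λ₀ v))

  module _ (ord : IsOrderingOfM _⪯_) where
    open IsOrderingOfM ord using (antisym)

    Step-functional : ∀ {s s₁ s₂} → WellFormed s → Step s s₁ → Step s s₂ → s₁ ≋ s₂
    Step-functional {s} {s₁} {s₂} wf (step M₁ k₁ _ ((w₁ , fw₁) , min₁) free₁ lab-W₁ lab-¬W₁ used₁ U₁)
                                     (step M₂ k₂ _ ((w₂ , fw₂) , min₂) free₂ lab-W₂ lab-¬W₂ used₂ U₂) =
      record { lab-≡ = lab-≡ ; used-⇔ = used-⇔ ; U-⇔ = U-⇔ }
      where
      M₁↭M₂ : M₁ ↭ M₂
      M₁↭M₂ = antisym M₁ M₂ (FW-InM wf fw₁) (FW-InM wf fw₂) (min₁ w₂ M₂ fw₂) (min₂ w₁ M₁ fw₁)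
      k₁≡k₂ : k₁ ≡ k₂
      k₁≡k₂ = IsMinFree-unique free₁ free₂
      W'₁⇔W'₂ : ∀ v → W' s M₁ v ⇔ W' s M₂ v
      W'₁⇔W'₂ v = mk⇔ (λ (m , fw , m↭) → m , fw , ↭-trans m↭ M₁↭M₂)
                      (λ (m , fw , m↭) → m , fw , ↭-trans m↭ (↭-sym M₁↭M₂))
      -- W' need not be decidable, but equality of labels is.
      lab-≡ : ∀ v → lab s₁ v ≡ lab s₂ v
      lab-≡ v = decidable-by-cases (≡-dec ℕ._≟_ (lab s₁ v) (lab s₂ v))
        (λ inW' → trans (lab-W₁ v inW') (trans (cong just k₁≡k₂) (sym (lab-W₂ v (to (W'₁⇔W'₂ v) inW')))))
        (λ ∉W' → trans (lab-¬W₁ v ∉W') (sym (lab-¬W₂ v (∉W' ∘ from (W'₁⇔W'₂ v)))))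
      used-⇔ : ∀ j → used s₁ j ⇔ used s₂ j
      used-⇔ j = ⇔-trans (used₁ j) (⇔-trans (⇔-refl ⊎-⇔ k⇔k) (⇔-sym (used₂ j)))
        where
        k⇔k : (j ≡ k₁) ⇔ (j ≡ k₂)
        k⇔k = mk⇔ (λ e → trans e k₁≡k₂) (λ e → trans e (sym k₁≡k₂))
      U-⇔ : ∀ v → U s₁ v ⇔ U s₂ v
      U-⇔ v = ⇔-trans (U₁ v) (⇔-trans (⇔-refl ×-⇔ ¬-cong-⇔ (W'₁⇔W'₂ v)) (⇔-sym (U₂ v)))

    Run-functional : ∀ {s o₁ o₂} → WellFormed s → Run s o₁ → Run s o₂ → ∀ v → o₁ v ≡ o₂ v
    Run-functional wf (done _ labs₁) (done _ labs₂) v = just-injective (trans (sym (labs₁ v)) (labs₂ v))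
    Run-functional wf (done ¬U _) (next _ (step _ _ (u , Uu) _ _ _ _ _ _) _) v = ⊥-elim (¬U u Uu)
    Run-functional wf (next _ (step _ _ (u , Uu) _ _ _ _ _ _) _) (done ¬U _) v = ⊥-elim (¬U u Uu)
    Run-functional wf (next s₁ st₁ r₁) (next s₂ st₂ r₂) =
      Run-functional (WellFormed-step wf st₁) r₁ (Run-resp-≋ (≋-sym (Step-functional wf st₁ st₂)) r₂)

module Covering (_⪯_ : List ℕ → List ℕ → Set) {V W : Set} (chV : V → List V) (chW : W → List W)
  (p : W → V) (p-children : ∀ x → map p (chW x) ≡ chV (p x)) (p-onto : ∀ v → Σ[ x ∈ W ] p x ≡ v) where
  module Base = Algorithm1 _⪯_ chV
  module Cover = Algorithm1 _⪯_ chW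
  module BaseRuns = RunProperties _⪯_ chV
  module CoverRuns = RunProperties _⪯_ chW

  pull : Base.State → Cover.State
  pull s = record { lab = Base.lab s ∘ p ; used = Base.used s ; U = Base.U s ∘ p }

  lift : {P : V → Set} → Σ V P → Σ W (P ∘ p)
  lift (v , Pv) with p-onto v
  ... | x , refl = x , Pv

  labels-∘ : ∀ (f : V → Maybe ℕ) xs → Cover.labels (f ∘ p) xs ≡ Base.labels f (map p xs)
  labels-∘ f []       = refl
  labels-∘ f (x ∷ xs) rewrite labels-∘ f xs with f (p x) | Base.labels f (map p xs)
  ... | just a  | just as = refl
  ... | just a  | nothing = refl
  ... | nothing | _       = refl

  labels-children : ∀ (f : V → Maybe ℕ) x → Cover.labels (f ∘ p) (chW x) ≡ Base.labels f (chV (p x))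
  labels-children f x = trans (labels-∘ f (chW x)) (cong (Base.labels f) (p-children x))

  FW-pull : ∀ s {x m} → Cover.FW (pull s) x m ⇔ Base.FW s (p x) m
  FW-pull s {x} = mk⇔ (λ (Ux , eq) → Ux , trans (sym (labels-children (Base.lab s) x)) eq)
                      (λ (Ux , eq) → Ux , trans (labels-children (Base.lab s) x) eq)

  W'-pull : ∀ s {M x} → Cover.W' (pull s) M x ⇔ Base.W' s M (p x)
  W'-pull s = mk⇔ (map₂ (λ (fw , m↭M) → to (FW-pull s) fw , m↭M))
                  (map₂ (λ (fw , m↭M) → from (FW-pull s) fw , m↭M))

  Step-pull : ∀ {s s′} → Base.Step s s′ → Cover.Step (pull s) (pull s′)
  Step-pull {s} (Base.step M k u (w , M-min) k-free lab-W' lab-¬W' used′⇔ U′⇔) =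
    Cover.step M k (lift u)
      (map₂ (from (FW-pull s)) (lift w) , λ x m fw → M-min (p x) m (to (FW-pull s) fw))
      k-free
      (λ x inW' → lab-W' (p x) (to (W'-pull s) inW'))
      (λ x ∉W' → lab-¬W' (p x) (∉W' ∘ from (W'-pull s)))
      used′⇔
      (λ x → ⇔-trans (U′⇔ (p x)) (⇔-refl ×-⇔ ¬-cong-⇔ (⇔-sym (W'-pull s))))

  Run-pull : ∀ {s out} → Base.Run s out → Cover.Run (pull s) (out ∘ p)
  Run-pull (Base.done ¬U labs) = Cover.done (¬U ∘ p) (labs ∘ p)
  Run-pull (Base.next s′ st r) = Cover.next (pull s′) (Step-pull st) (Run-pull r)

  leaf-pull : ∀ x → Cover.Leaf x ⇔ Base.Leaf (p x)
  leaf-pull x = subst (λ ys → Cover.Leaf x ⇔ isLeaf ys) (p-children x) (isLeaf-map (chW x))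

  initAux-pull : ∀ ys {xs} → map p ys ≡ xs → {g : isLeaf ys → ℕ} {h : isLeaf xs → ℕ} →
                 (∀ q q′ → g q ≡ h q′) → Cover.initAux ys g ≡ Base.initAux xs h
  initAux-pull []      refl g≡h = cong just (g≡h tt tt)
  initAux-pull (_ ∷ _) refl g≡h = refl

  Init-pull : ∀ {λ₀ : (v : V) → Base.Leaf v → ℕ} {out : V → ℕ} → (∀ v q → out v ≡ λ₀ v q) →
              CoverRuns._≋_ (Cover.Init (λ x _ → out (p x))) (pull (Base.Init λ₀))
  Init-pull {λ₀} {out} out-leaf = record
    { lab-≡  = λ x → initAux-pull (chW x) (p-children x) (λ _ q → out-leaf (p x) q)
    ; used-⇔ = λ j → mk⇔ (λ (x , q , eq) → p x , to (leaf-pull x) q , trans (sym (out-leaf (p x) _)) eq)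
                         used-lift
    ; U-⇔    = λ x → ¬-cong-⇔ (leaf-pull x) }
    where
    used-lift : ∀ {j} → Base.used (Base.Init λ₀) j → Cover.used (Cover.Init (λ x _ → out (p x))) j
    used-lift (v , q , eq) with p-onto v
    ... | x , refl = x , from (leaf-pull x) q , trans (out-leaf (p x) q) eq

  Alg1-pull : ∀ {λ₀ : (v : V) → Base.Leaf v → ℕ} {out : V → ℕ} →
              Base.Alg1 λ₀ out → Cover.Alg1 (λ x _ → out (p x)) (out ∘ p)
  Alg1-pull run = CoverRuns.Run-resp-≋ (CoverRuns.≋-sym (Init-pull (BaseRuns.Alg1-leaf run))) (Run-pull run)

  Alg1-pull-unique : IsOrderingOfM _⪯_ → ∀ {λ₀ : (v : V) → Base.Leaf v → ℕ} {out : V → ℕ} →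
                     (∀ v q → 1 ≤ λ₀ v q) → Base.Alg1 λ₀ out →
                     ∀ ψ → Cover.Alg1 (λ x _ → out (p x)) ψ → ∀ x → ψ x ≡ out (p x)
  Alg1-pull-unique ord {λ₀} {out} pos run ψ runψ =
    CoverRuns.Run-functional ord (CoverRuns.WellFormed-Init pulled-positive) runψ (Alg1-pull run)
    where
    pulled-positive : ∀ x (q : Cover.Leaf x) → 1 ≤ out (p x)
    pulled-positive x q = subst (1 ≤_) (sym (BaseRuns.Alg1-leaf run (p x) q′)) (pos (p x) q′)
      where
      q′ : Base.Leaf (p x)
      q′ = to (leaf-pull x) q

module UnfoldingProperties {n : ℕ} (ch : Fin n → List (Fin n)) (ρ : Fin n) where
  open Unfolding ch ρ

  map-proj₁-ch' : ∀ x → map proj₁ (ch' x) ≡ ch (proj₁ x)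
  map-proj₁-ch' (u , π) = begin
    map proj₁ (map (λ i → lookup (ch u) i , ext π i) (allFin (length (ch u)))) ≡⟨ map-∘ (allFin _) ⟨
    map (lookup (ch u)) (allFin (length (ch u)))                                ≡⟨ map-tabulate id (lookup (ch u)) ⟩
    tabulate (lookup (ch u))                                                    ≡⟨ tabulate-lookup (ch u) ⟩
    ch u                                                                        ∎
    where open ≡-Reasoning

  module _ (net : IsRootedNetwork n ch ρ) where
    open IsRootedNetwork net

    parent : Fin n → Fin n
    parent v with v ≟ ρ
    ... | yes _   = ρ
    ... | no v≢ρ = proj₁ (others-have-parent v v≢ρ)

    child-of-parent : ∀ v → v ≢ ρ → v ∈ ch (parent v)
    child-of-parent v v≢ρ with v ≟ ρ
    ... | yes v≡ρ  = ⊥-elim (v≢ρ v≡ρ)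
    ... | no v≢ρ′ = proj₂ (others-have-parent v v≢ρ′)

    PathTo-parent⇒PathTo : ∀ v → PathTo (parent v) → PathTo v
    PathTo-parent⇒PathTo v π with v ≟ ρ
    ... | yes refl = start
    ... | no v≢ρ  = subst PathTo (sym (lookup-index v∈)) (ext π (index v∈))
      where
      v∈ : v ∈ ch (proj₁ (others-have-parent v v≢ρ))
      v∈ = proj₂ (others-have-parent v v≢ρ)

    ancestor : ℕ → Fin n → Fin n
    ancestor zero    v = v
    ancestor (suc i) v = parent (ancestor i v)

    PathTo-ancestor⇒PathTo : ∀ i v → PathTo (ancestor i v) → PathTo v
    PathTo-ancestor⇒PathTo zero    v π = π
    PathTo-ancestor⇒PathTo (suc i) v π = PathTo-ancestor⇒PathTo i v (PathTo-parent⇒PathTo (ancestor i v) π)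

    ancestor-Reach⁺ : ∀ v {i j} → i < j → (∀ k → k < j → ancestor k v ≢ ρ) →
                      Reach⁺ ch (ancestor j v) (ancestor i v)
    ancestor-Reach⁺ v {i} {suc j} i<1+j ≢ρ with m<1+n⇒m<n∨m≡n i<1+j
    ... | inj₁ i<j  = step (child-of-parent _ (≢ρ j (n<1+n j)))
                           (ancestor-Reach⁺ v i<j (λ k k<j → ≢ρ k (m<n⇒m<1+n k<j)))
    ... | inj₂ refl = edge (child-of-parent _ (≢ρ i (n<1+n i)))

    -- Among the n + 1 ancestors v, parent v, …, two coincide; unless one of
    -- them is ρ, this closes a cycle.
    pathTo : ∀ v → PathTo v
    pathTo v with any? (λ (i : Fin (suc n)) → ancestor (toℕ i) v ≟ ρ)
    ... | yes (i , ancestor≡ρ) = PathTo-ancestor⇒PathTo (toℕ i) v (subst PathTo (sym ancestor≡ρ) start)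
    ... | no ¬∃ with pigeonhole (n<1+n n) (λ i → ancestor (toℕ i) v)
    ...   | i , j , i<j , same =
      ⊥-elim (acyclic _ (subst (Reach⁺ ch _) same
        (ancestor-Reach⁺ v i<j (λ k k<j → ancestors-≢ρ k (<-trans k<j (toℕ<n j))))))
      where
      ancestors-≢ρ : ∀ k → k < suc n → ancestor k v ≢ ρ
      ancestors-≢ρ k k<1+n eq =
        ¬∃ (fromℕ< k<1+n , subst (λ i → ancestor i v ≡ ρ) (sym (toℕ-fromℕ< k<1+n)) eq)

lemma5p1 : (_⪯_ : List ℕ → List ℕ → Set) → IsOrderingOfM _⪯_ →
             (n : ℕ) (ch : Fin n → List (Fin n)) (ρ : Fin n) → IsRootedNetwork n ch ρ →
             (λ₀ : (v : Fin n) → isLeaf (ch v) → ℕ) → (∀ v p → 1 ≤ λ₀ v p) →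
             (φ : Fin n → ℕ) → Algorithm1.Alg1 _⪯_ ch λ₀ φ →
             Algorithm1.Alg1 _⪯_ (Unfolding.ch' ch ρ) (Unfolding.unfoldLeafLab ch ρ φ) (Unfolding.unfoldLab ch ρ φ)
             × (∀ ψ → Algorithm1.Alg1 _⪯_ (Unfolding.ch' ch ρ) (Unfolding.unfoldLeafLab ch ρ φ) ψ →
                ∀ x → ψ x ≡ Unfolding.unfoldLab ch ρ φ x)
lemma5p1 _⪯_ ord n ch ρ net λ₀ λ₀-positive φ run =
  Alg1-pull run , Alg1-pull-unique ord λ₀-positive run
  where
  open Unfolding ch ρ using (ch')
  open UnfoldingProperties ch ρ using (map-proj₁-ch'; pathTo)
  open Covering _⪯_ ch ch' proj₁ map-proj₁-ch' (λ v → (v , pathTo net v) , refl)
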